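{- Let $c=s_{n-1}s_{n-2}\cdots s_1$ and let $\omega\in\Omega^{NC}_c$. Then for blocks $B_{[i,j]},B_{[k,l]}$ of $\omega$, $B_{[i,j]}\preceq B_{[k,l]}$ in $\omega$ if and only if $[k,l]\subseteq[i,j]$.
   Context: $S_n$ is generated by $s_i=(i,i+1)$. For $c=s_{n-1}\cdots s_1$, every $i\in\{2,\ldots,n-1\}$ is upper-barred, and the cycle of $c$ is $1,n,n-1,\ldots,2$ clockwise. A pre-order on $[n]$ is a reflexive transitive relation; blocks are classes of $i\equiv j\iff i\preceq j\preceq i$; $B_{[i,j]}$ denotes the block with minimum $i$ and maximum $j$; blocks overlap if their intervals intersect. $\omega\in\Omega$ means (P1) overlapping blocks comparable and (P2) every cover between blocks is between overlapping blocks. $\omega\in\Omega^{NC}_c$ means moreover: (1) the blocks form a noncrossing partition of the points placed on the circle in the cycle order of $c$ (convex hulls pairwise disjoint), and (2) for distinct overlapping blocks $B,B'$ and $x\in B'$ with $\min B<x<\max B$: if $x$ is upper-barred then $B\prec B'$ (and if lower-barred then $B\succ B'$). -}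

module Defs where

open import Data.Bool using (Bool; T)
open import Data.Nat as ℕ using (ℕ; zero; suc; _∸_)
open import Data.Fin using (Fin; toℕ; _≤_; _<_)
open import Data.Product using (_×_; ∃; ∃-syntax; _,_)
open import Data.Sum using (_⊎_)
open import Relation.Nullary using (¬_)

-- The ground set [n] = {1,…,n} is represented by Fin n; the element
-- m ∈ [n] is the Fin-value with toℕ = m - 1.  The order on [n] is the
-- usual one (Data.Fin._≤_ / _<_, i.e. comparison of toℕ).

record PreOrder (n : ℕ) : Set where
  field
    rel     : Fin n → Fin n → Bool
    reflex  : ∀ x → T (rel x x)
    transit : ∀ x y z → T (rel x y) → T (rel y z) → T (rel x z)

module _ {n : ℕ} (ω : PreOrder n) where
  open PreOrder ω

  _≼_ : Fin n → Fin n → Set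
  x ≼ y = T (rel x y)

  _≈ᵇ_ : Fin n → Fin n → Set
  x ≈ᵇ y = (x ≼ y) × (y ≼ x)

  _≺_ : Fin n → Fin n → Set
  x ≺ y = (x ≼ y) × ¬ (y ≼ x)

  -- The block of a has minimum i and maximum j, i.e. it is B_[i,j].
  BlockSpan : Fin n → Fin n → Fin n → Set
  BlockSpan a i j = (i ≈ᵇ a) × (j ≈ᵇ a) × (∀ x → x ≈ᵇ a → (i ≤ x) × (x ≤ j))

  Overlap : Fin n → Fin n → Set
  Overlap a b = ∃ λ (i : Fin n) → ∃ λ (j : Fin n) → ∃ λ (k : Fin n) → ∃ λ (l : Fin n) → ∃ λ (t : Fin n) →
    (BlockSpan a i j × BlockSpan b k l × (i ≤ t) × (t ≤ j) × (k ≤ t) × (t ≤ l))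

  Comparable : Fin n → Fin n → Set
  Comparable a b = (a ≼ b) ⊎ (b ≼ a)

  Covers : Fin n → Fin n → Set
  Covers a b = (a ≺ b) × ¬ (∃ λ (c : Fin n) → (a ≺ c) × (c ≺ b))

  P1 : Set
  P1 = ∀ a b → Overlap a b → Comparable a b

  P2 : Set
  P2 = ∀ a b → Covers a b → Overlap a b

  InΩ : Set
  InΩ = P1 × P2

-- Position of an element in the cycle of c = s_{n-1} ⋯ s_1, which is
-- 1, n, n-1, …, 2 read clockwise:  pos(1) = 0, pos(m) = n + 1 - m (m ≥ 2).
cyclePos : {n : ℕ} → Fin n → ℕ
cyclePos {n} x with toℕ x
... | zero  = zero
... | suc v = n ∸ suc v

-- For c = s_{n-1} ⋯ s_1 every i ∈ {2,…,n-1} is upper-barred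
-- (in Fin terms: 1 ≤ toℕ x and toℕ x + 2 ≤ n).
UpperBarred : {n : ℕ} → Fin n → Set
UpperBarred {n} x = (1 ℕ.≤ toℕ x) × (suc (suc (toℕ x)) ℕ.≤ n)

-- Lower-barred: an element of {2,…,n-1} that is not upper-barred
-- (there are none for this c).
LowerBarred : {n : ℕ} → Fin n → Set
LowerBarred {n} x = (1 ℕ.≤ toℕ x) × (suc (suc (toℕ x)) ℕ.≤ n) × ¬ UpperBarred x

module _ {n : ℕ} (ω : PreOrder n) where

  -- The blocks of a and b cross when the points are placed on the circle
  -- in the cycle order of c: there are p, r in the block of a and q, s in
  -- the block of b appearing in the cyclic order p, q, r, s.
  -- (For points in convex position on a circle this is exactly the failure
  -- of disjointness of the convex hulls.)
  Crossing : Fin n → Fin n → Set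
  Crossing a b = ∃ λ (p : Fin n) → ∃ λ (q : Fin n) → ∃ λ (r : Fin n) → ∃ λ (s : Fin n) →
    (_≈ᵇ_ ω p a × _≈ᵇ_ ω r a × _≈ᵇ_ ω q b × _≈ᵇ_ ω s b ×
     (cyclePos p ℕ.< cyclePos q) × (cyclePos q ℕ.< cyclePos r) × (cyclePos r ℕ.< cyclePos s))

  NCCond1 : Set
  NCCond1 = ∀ a b → ¬ (_≈ᵇ_ ω a b) → ¬ Crossing a b

  NCCond2 : Set
  NCCond2 = ∀ a b x i j → ¬ (_≈ᵇ_ ω a b) → Overlap ω a b → _≈ᵇ_ ω x b →
    BlockSpan ω a i j → i < x → x < j →
    (UpperBarred x → _≺_ ω a b) × (LowerBarred x → _≺_ ω b a)

  InΩNC : Set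
  InΩNC = InΩ ω × NCCond1 × NCCond2

module Submission where

-- Only (P2) and condition (2) of Ω^NC_c are needed.  For this c every
-- x ∈ {2,…,n-1} is upper-barred, so (2) says: if a point of the block B'
-- lies strictly inside the interval of a distinct overlapping block B,
-- then B ≺ B'.
--   (⇐) If [k,l] ⊆ [i,j] the blocks coincide or k lies strictly inside
--       [i,j]; in the latter case (2) gives B_[i,j] ≺ B_[k,l].
--   (⇒) If a ≺ b is a cover, (P2) makes the blocks overlap, and (2)
--       forbids any point of the block of a strictly inside the interval of
--       the block of b, which forces that interval inside the one of a.
--       "The block of b lies in the hull of the block of a" is transitive,
--       and on a finite set a transitive relation containing all covers of a
--       strict order contains the whole order (cover induction below).

open import Defs
open import Data.Nat using (ℕ)
open import Data.Fin using (Fin; _≤_)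
open import Data.Product using (_×_)
open import Function.Bundles using (_⇔_)

open import Level using (Level)
open import Data.Bool.Properties using (T?)
import Data.Nat as ℕ
import Data.Nat.Properties as ℕ
open import Data.Fin using (_<_)
open import Data.Fin.Properties using (toℕ<n; any?; _≤?_; _≟_; ≤∧≢⇒<)
open import Data.Fin.Induction using (spo-wellFounded; spo-noetherian)
open import Data.Product using (∃; _,_; proj₁; proj₂)
open import Function.Base using (flip)
open import Function.Bundles using (mk⇔)
open import Induction.WellFounded using (Acc; acc)
open import Relation.Binary.Core using (Rel; _⇒_)
open import Relation.Binary.Definitions using (Transitive; Decidable)
open import Relation.Binary.Structures using (IsStrictPartialOrder)
open import Relation.Binary.PropositionalEquality using (_≡_; _≢_; refl; sym; resp₂; isEquivalence)
open import Relation.Nullary using (¬_; yes; no; contradiction)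
open import Relation.Nullary.Decidable using (_×-dec_; ¬?)

-- In a decidable strict partial order on a finite set,
-- any transitive relation that holds along every cover relation holds
-- along the whole order: a non-cover a ⊏ b splits as a ⊏ c ⊏ b, and both
-- halves are smaller (c is lower than b, and higher than a), which is
-- well-founded because Fin n is finite.
module CoverInduction {n : ℕ} {ℓ : Level} {_⊏_ : Rel (Fin n) ℓ}
  (isSPO : IsStrictPartialOrder _≡_ _⊏_) (_⊏?_ : Decidable _⊏_) where

  Cover : Rel (Fin n) ℓ
  Cover a b = (a ⊏ b) × ¬ (∃ λ c → (a ⊏ c) × (c ⊏ b))

  cover-induction : ∀ {r : Level} (N : Rel (Fin n) r) →
    Transitive N → Cover ⇒ N → _⊏_ ⇒ N
  cover-induction N N-trans N-cover {a} {b} =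
    go (spo-wellFounded isSPO b) (spo-noetherian isSPO a)
    where
    go : ∀ {a b} → Acc _⊏_ b → Acc (flip _⊏_) a → a ⊏ b → N a b
    go {a} {b} acc-b@(acc below-b) acc-a@(acc above-a) a⊏b
      with any? (λ c → (a ⊏? c) ×-dec (c ⊏? b))
    ... | no  no-between = N-cover (a⊏b , no-between)
    ... | yes (c , a⊏c , c⊏b) =
      N-trans (go (below-b c⊏b) acc-a a⊏c) (go acc-b (above-a a⊏c) c⊏b)

between⇒upper-barred : ∀ {n} {i x j : Fin n} → i < x → x < j → UpperBarred x
between⇒upper-barred {j = j} i<x x<j =
  ℕ.≤-trans (ℕ.s≤s ℕ.z≤n) i<x , ℕ.≤-trans (ℕ.s≤s x<j) (toℕ<n j)

module Blocks {n : ℕ} (ω : PreOrder n) where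
  open PreOrder ω

  _⊑_ _∼_ _⊏_ : Fin n → Fin n → Set
  _⊑_ = _≼_ ω
  _∼_ = _≈ᵇ_ ω
  _⊏_ = _≺_ ω

  ⊑-trans : ∀ {x y z} → x ⊑ y → y ⊑ z → x ⊑ z
  ⊑-trans {x} {y} {z} = transit x y z

  ∼-sym : ∀ {x y} → x ∼ y → y ∼ x
  ∼-sym (x⊑y , y⊑x) = y⊑x , x⊑y

  ∼-trans : ∀ {x y z} → x ∼ y → y ∼ z → x ∼ z
  ∼-trans (x⊑y , y⊑x) (y⊑z , z⊑y) = ⊑-trans x⊑y y⊑z , ⊑-trans z⊑y y⊑x

  ⊏-isStrictPartialOrder : IsStrictPartialOrder _≡_ _⊏_
  ⊏-isStrictPartialOrder = record
    { isEquivalence = isEquivalence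
    ; irrefl        = λ { refl (_ , x⋢x) → x⋢x (reflex _) }
    ; trans         = λ (x⊑y , y⋢x) (y⊑z , _) →
                        ⊑-trans x⊑y y⊑z , λ z⊑x → y⋢x (⊑-trans y⊑z z⊑x)
    ; <-resp-≈      = resp₂ _⊏_
    }

  _⊏?_ : Decidable _⊏_
  x ⊏? y = T? (rel x y) ×-dec ¬? (T? (rel y x))

  ⊏⇒disjoint : ∀ {a b p q} → a ⊏ b → p ∼ a → q ∼ b → p ≢ q
  ⊏⇒disjoint (_ , b⋢a) (p⊑a , _) (_ , b⊑q) refl = b⋢a (⊑-trans b⊑q p⊑a)

  overlap-sym : ∀ {a b} → Overlap ω a b → Overlap ω b a
  overlap-sym (i , j , k , l , t , span-a , span-b , i≤t , t≤j , k≤t , t≤l) =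
    k , l , i , j , t , span-b , span-a , k≤t , t≤l , i≤t , t≤j

  InHull : Fin n → Fin n → Set
  InHull a x = ∃ λ y → ∃ λ z → (y ∼ a) × (z ∼ a) × (y ≤ x) × (x ≤ z)

  Nested : Fin n → Fin n → Set
  Nested a b = ∀ x → x ∼ b → InHull a x

  nested-trans : Transitive Nested
  nested-trans a⊇b b⊇c x x∼c with b⊇c x x∼c
  ... | y , z , y∼b , z∼b , y≤x , x≤z with a⊇b y y∼b | a⊇b z z∼b
  ... | y′ , _ , y′∼a , _ , y′≤y , _ | _ , z′ , _ , z′∼a , _ , z≤z′ =
    y′ , z′ , y′∼a , z′∼a , ℕ.≤-trans y′≤y y≤x , ℕ.≤-trans x≤z z≤z′

  hull⊆span : ∀ {a i j x} → BlockSpan ω a i j → InHull a x → (i ≤ x) × (x ≤ j)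
  hull⊆span (_ , _ , a-bounds) (y , z , y∼a , z∼a , y≤x , x≤z) =
    ℕ.≤-trans (proj₁ (a-bounds y y∼a)) y≤x , ℕ.≤-trans x≤z (proj₂ (a-bounds z z∼a))

  same-block⇒nested : ∀ {a b} → a ∼ b → Nested a b
  same-block⇒nested a∼b x x∼b = x , x , x∼a , x∼a , ℕ.≤-refl , ℕ.≤-refl
    where x∼a = ∼-trans x∼b (∼-sym a∼b)

  nested⇒interval-⊆ : ∀ {a b i j k l} → BlockSpan ω a i j → BlockSpan ω b k l →
    Nested a b → (i ≤ k) × (l ≤ j)
  nested⇒interval-⊆ span-a (k∼b , l∼b , _) a⊇b =
    proj₁ (hull⊆span span-a (a⊇b _ k∼b)) , proj₂ (hull⊆span span-a (a⊇b _ l∼b))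

module NoncrossingBlocks {n : ℕ} (ω : PreOrder n) (nc₂ : NCCond2 ω) where
  open Blocks ω

  interior-point⇒⊏ : ∀ {a b x i j} → ¬ (a ∼ b) → Overlap ω a b → x ∼ b →
    BlockSpan ω a i j → i < x → x < j → a ⊏ b
  interior-point⇒⊏ a≁b ov x∼b span-a i<x x<j =
    proj₁ (nc₂ _ _ _ _ _ a≁b ov x∼b span-a i<x x<j) (between⇒upper-barred i<x x<j)

  no-interior-point : ∀ {a b p k l} → a ⊏ b → Overlap ω a b → p ∼ a →
    BlockSpan ω b k l → ¬ ((k < p) × (p < l))
  no-interior-point {a} {b} (_ , b⋢a) ov p∼a span-b (k<p , p<l) =
    b⋢a (proj₁ (interior-point⇒⊏ b≁a (overlap-sym ov) p∼a span-b k<p p<l))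
    where
    b≁a : ¬ (b ∼ a)
    b≁a (b⊑a , _) = b⋢a b⊑a

  -- If min B_a > min B_b, then min B_a
  -- would be an interior point of B_b (it is ≤ the common point ≤ max B_b,
  -- and differs from max B_b); symmetrically for the maxima.
  overlapping-⊏⇒nested : ∀ {a b} → a ⊏ b → Overlap ω a b → Nested a b
  overlapping-⊏⇒nested a⊏b
    ov@(i , j , k , l , t , (i∼a , j∼a , _) , span-b@(k∼b , l∼b , b-bounds) ,
        i≤t , t≤j , k≤t , t≤l) x x∼b =
    i , j , i∼a , j∼a ,
    ℕ.≤-trans i≤k (proj₁ (b-bounds x x∼b)) , ℕ.≤-trans (proj₂ (b-bounds x x∼b)) l≤j
    where
    i≤k : i ≤ k
    i≤k with i ≤? k
    ... | yes i≤k = i≤k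
    ... | no  i≰k = contradiction
      (ℕ.≰⇒> i≰k , ≤∧≢⇒< (ℕ.≤-trans i≤t t≤l) (⊏⇒disjoint a⊏b i∼a l∼b))
      (no-interior-point a⊏b ov i∼a span-b)
    l≤j : l ≤ j
    l≤j with l ≤? j
    ... | yes l≤j = l≤j
    ... | no  l≰j = contradiction
      (≤∧≢⇒< (ℕ.≤-trans k≤t t≤j) (λ k≡j → ⊏⇒disjoint a⊏b j∼a k∼b (sym k≡j)) , ℕ.≰⇒> l≰j)
      (no-interior-point a⊏b ov j∼a span-b)

module BlockOrder {n : ℕ} (ω : PreOrder n) (p₂ : P2 ω) (nc₂ : NCCond2 ω) where
  open PreOrder ω
  open Blocks ω
  open NoncrossingBlocks ω nc₂
  open CoverInduction ⊏-isStrictPartialOrder _⊏?_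

  -- By (P2) every cover is between overlapping blocks, so covers are
  -- nested; cover induction extends this to the whole order.
  ⊑⇒nested : ∀ {a b} → a ⊑ b → Nested a b
  ⊑⇒nested {a} {b} a⊑b with T? (rel b a)
  ... | yes b⊑a = same-block⇒nested (a⊑b , b⊑a)
  ... | no  b⋢a = cover-induction Nested nested-trans
    (λ cover → overlapping-⊏⇒nested (proj₁ cover) (p₂ _ _ cover)) (a⊑b , b⋢a)

  -- Conversely, if [k,l] ⊆ [i,j] the blocks share an endpoint (and then
  -- coincide) or k is an interior point of [i,j], and (2) applies.
  interval-⊆⇒⊑ : ∀ {a b i j k l} → BlockSpan ω a i j → BlockSpan ω b k l →
    (i ≤ k) × (l ≤ j) → a ⊑ b
  interval-⊆⇒⊑ {a} {b} {i} {j} {k} {l}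
    span-a@(i∼a , j∼a , _) span-b@(k∼b , l∼b , b-bounds) (i≤k , l≤j)
    with i ≟ k | l ≟ j
  ... | yes refl | _        = ⊑-trans (proj₂ i∼a) (proj₁ k∼b)
  ... | no  _    | yes refl = ⊑-trans (proj₂ j∼a) (proj₁ l∼b)
  ... | no  i≢k  | no  l≢j  = proj₁ (interior-point⇒⊏ a≁b blocks-overlap k∼b span-a i<k k<j)
    where
    i<k : i < k
    i<k = ≤∧≢⇒< i≤k i≢k
    l<j : l < j
    l<j = ≤∧≢⇒< l≤j l≢j
    k≤l : k ≤ l
    k≤l = proj₂ (b-bounds k k∼b)
    k<j : k < j
    k<j = ℕ.≤-<-trans k≤l l<j
    a≁b : ¬ (a ∼ b)
    a≁b a∼b = ℕ.<⇒≱ l<j (proj₂ (b-bounds j (∼-trans j∼a a∼b)))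
    blocks-overlap : Overlap ω a b
    blocks-overlap =
      i , j , k , l , k , span-a , span-b , ℕ.<⇒≤ i<k , ℕ.<⇒≤ k<j , ℕ.≤-refl , k≤l

corollary5p6 : {n : ℕ} (ω : PreOrder n) → InΩNC ω →
    (a b i j k l : Fin n) → BlockSpan ω a i j → BlockSpan ω b k l →
    (_≼_ ω a b ⇔ ((i ≤ k) × (l ≤ j)))
corollary5p6 ω ((_ , p₂) , _ , nc₂) a b i j k l span-a span-b = mk⇔
  (λ a⊑b → nested⇒interval-⊆ span-a span-b (⊑⇒nested a⊑b))
  (interval-⊆⇒⊑ span-a span-b)
  where
  open Blocks ω using (nested⇒interval-⊆)
  open BlockOrder ω p₂ nc₂
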